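{- The plus version of a transitive avoidance game is not a Player I win.
   Context: An avoidance game consists of a finite set $X$ (the board) and a family $\mathcal{L}$ of subsets of $X$ (the lines). It is transitive if its automorphism group (the group of permutations of $X$ mapping $\mathcal{L}$ onto $\mathcal{L}$) acts transitively on $X$. In the plus version of the game, Player I and Player II alternate moves, Player I first; on each move the player claims a non-empty set of previously unclaimed points (of any size). The first player to have claimed all points of some line loses; if all points are claimed and no player has completed a line, the game is a draw. The game is a Player I win if Player I has a strategy guaranteeing that Player II loses. -}

module Defs where

open import Data.Nat using (ℕ)
open import Data.Fin using (Fin)
open import Data.Fin.Subset using (Subset; ⊥; _⊆_; _∪_; ∁; Nonempty)
open import Data.Fin.Permutation using (Permutation′; _⟨$⟩ʳ_; _⟨$⟩ˡ_)
open import Data.Vec using (tabulate; lookup)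
open import Data.List using (List)
open import Data.List.Membership.Propositional using (_∈_)
open import Data.Product using (Σ; _×_; ∃)
open import Data.Sum using (_⊎_)
open import Relation.Binary.PropositionalEquality using (_≡_)
open import Relation.Nullary using (¬_)

record AvoidanceGame : Set where
  field
    size  : ℕ
    lines : List (Subset size)
open AvoidanceGame public

image : ∀ {n} → Permutation′ n → Subset n → Subset n
image σ S = tabulate (λ j → lookup S (σ ⟨$⟩ˡ j))

IsAutomorphism : (G : AvoidanceGame) → Permutation′ (size G) → Set
IsAutomorphism G σ =
  (∀ ℓ → ℓ ∈ lines G → image σ ℓ ∈ lines G) ×
  (∀ ℓ → ℓ ∈ lines G → Σ (Subset (size G)) λ m → m ∈ lines G × image σ m ≡ ℓ)

Transitive : AvoidanceGame → Set
Transitive G = ∀ (x y : Fin (size G)) →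
  Σ (Permutation′ (size G)) λ σ → IsAutomorphism G σ × σ ⟨$⟩ʳ x ≡ y

CompletesLine : (G : AvoidanceGame) → Subset (size G) → Set
CompletesLine G A = Σ (Subset (size G)) λ ℓ → ℓ ∈ lines G × ℓ ⊆ A

-- A legal move in position (A , B) (points claimed by I and by II):
-- a non-empty set of previously unclaimed points.
LegalMove : ∀ {n} → Subset n → Subset n → Subset n → Set
LegalMove A B S = Nonempty S × S ⊆ ∁ (A ∪ B)

-- Since the game is finite,
-- the inductively defined predicate is exactly "a strategy for I such that every
-- play consistent with it ends with Player II completing a line".
mutual
  -- Player I to move, A = points of I, B = points of II.
  data IWinsI (G : AvoidanceGame) : Subset (size G) → Subset (size G) → Set where
    moveI : ∀ {A B} (S : Subset (size G)) →
            LegalMove A B S →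
            ¬ CompletesLine G (A ∪ S) →   -- I does not complete a line (else I loses)
            IWinsII G (A ∪ S) B →
            IWinsI G A B

  -- Player II to move.  There must be an available move (otherwise: draw),
  -- and every move either completes a line of II (II loses) or leads to a
  -- position won by I.
  data IWinsII (G : AvoidanceGame) : Subset (size G) → Subset (size G) → Set where
    replyII : ∀ {A B} →
              Nonempty (∁ (A ∪ B)) →
              (∀ S → LegalMove A B S →
                 CompletesLine G (B ∪ S) ⊎ IWinsI G A (B ∪ S)) →
              IWinsII G A B


PlayerIWin : AvoidanceGame → Set
PlayerIWin G = IWinsI G ⊥ ⊥

module Submission where

-- Suppose Player I wins, opening with the set S.  Then I also wins the
-- position (A , ∅) with A = ∅ ∪ S and II to move.  Since the game is not over,
-- some point y is still free; transitivity gives an automorphism σ with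
-- σ y = x for a point x ∈ S, so x ∉ σ[A].  Automorphisms transport
-- winning positions (transport-II), hence I also wins (σ[A] , ∅) with II
-- to move.  There II answers with T = A ∖ σ[A] (non-empty, as it contains x),
-- reaching a position won by I in which II's points are among I's points
-- in the original game.  Playing the two games side by side, II copies I's
-- moves across the boards (mirror-I / mirror-II): whoever completes a line
-- in one game has completed it for the other player in the other game, and
-- the two strategies cannot both win.

open import Defs
open import Relation.Nullary using (¬_)
open import Data.Nat using (ℕ)
open import Data.Fin.Subset using (Subset; ⊥; _⊆_; _∪_; _∩_; ∁; Nonempty; _∈_; _∉_)
open import Data.Fin.Subset.Properties
  using (∉⊥; ⊥⊆; x∈∁p⇒x∉p; x∉p⇒x∈∁p; x∈p∪q⁻; x∈p∪q⁺; x∈p∩q⁺; p⊆p∪q; q⊆p∪q;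
         p∩q⊆p; p∩q⊆q; _∈?_; ⊆-refl; ⊆-reflexive; ⊆-trans; ⊆-antisym; p⊆q⇒∁p⊇∁q; ∪-assoc)
open import Data.Fin.Permutation using (Permutation′; _⟨$⟩ʳ_; _⟨$⟩ˡ_; inverseˡ; flip)
open import Data.Vec.Properties using (lookup∘tabulate; []=⇒lookup; lookup⇒[]=)
open import Data.Product using (_,_; proj₁; proj₂)
open import Data.Sum using (_⊎_; inj₁; inj₂)
import Data.Empty as Empty
open import Relation.Binary.PropositionalEquality
  using (_≡_; sym; trans; cong; subst; subst₂; module ≡-Reasoning)
open import Relation.Nullary using (yes; no)

module _ {n : ℕ} where

  ∪-lub : ∀ {A B C : Subset n} → A ⊆ C → B ⊆ C → A ∪ B ⊆ C
  ∪-lub {A} {B} A⊆C B⊆C p with x∈p∪q⁻ A B p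
  ... | inj₁ a = A⊆C a
  ... | inj₂ b = B⊆C b

  ∪-mono : ∀ {A A′ B B′ : Subset n} → A ⊆ A′ → B ⊆ B′ → A ∪ B ⊆ A′ ∪ B′
  ∪-mono {A′ = A′} {B′ = B′} A⊆A′ B⊆B′ =
    ∪-lub (⊆-trans A⊆A′ (p⊆p∪q B′)) (⊆-trans B⊆B′ (q⊆p∪q A′ B′))

  ⊆-∪-diff : ∀ (X Y : Subset n) → X ⊆ Y ∪ (X ∩ ∁ Y)
  ⊆-∪-diff X Y {x} x∈X with x ∈? Y
  ... | yes x∈Y = x∈p∪q⁺ (inj₁ x∈Y)
  ... | no  x∉Y = x∈p∪q⁺ (inj₂ (x∈p∩q⁺ (x∈X , x∉p⇒x∈∁p x∉Y)))

  ∪-extend : ∀ {A P Q : Subset n} (S : Subset n) → A ⊆ P ∪ Q → A ∪ S ⊆ P ∪ (Q ∪ S)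
  ∪-extend {P = P} {Q} S A⊆PQ =
    ∪-lub (⊆-trans A⊆PQ (∪-mono ⊆-refl (p⊆p∪q S))) (⊆-trans (q⊆p∪q Q S) (q⊆p∪q P (Q ∪ S)))

module _ {n : ℕ} (σ : Permutation′ n) where

  ∈-image⁺ : ∀ {S j} → σ ⟨$⟩ˡ j ∈ S → j ∈ image σ S
  ∈-image⁺ {S} {j} p = lookup⇒[]= j (image σ S) (trans (lookup∘tabulate _ j) ([]=⇒lookup p))

  ∈-image⁻ : ∀ {S j} → j ∈ image σ S → σ ⟨$⟩ˡ j ∈ S
  ∈-image⁻ {S} {j} p = lookup⇒[]= _ S (trans (sym (lookup∘tabulate _ j)) ([]=⇒lookup p))

  ∈-image : ∀ {S x} → x ∈ S → σ ⟨$⟩ʳ x ∈ image σ S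
  ∈-image {S} p = ∈-image⁺ (subst (_∈ S) (sym (inverseˡ σ)) p)

  ∈-image-reflect : ∀ {S x} → σ ⟨$⟩ʳ x ∈ image σ S → x ∈ S
  ∈-image-reflect {S} p = subst (_∈ S) (inverseˡ σ) (∈-image⁻ p)

  image-mono : ∀ {A B} → A ⊆ B → image σ A ⊆ image σ B
  image-mono A⊆B p = ∈-image⁺ (A⊆B (∈-image⁻ p))

  image-reflects-⊆ : ∀ {A B} → image σ A ⊆ image σ B → A ⊆ B
  image-reflects-⊆ σA⊆σB p = ∈-image-reflect (σA⊆σB (∈-image p))

  image-∪ : ∀ A B → image σ (A ∪ B) ≡ image σ A ∪ image σ B
  image-∪ A B = ⊆-antisym
    (λ p → image-∪-split (x∈p∪q⁻ A B (∈-image⁻ {A ∪ B} p)))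
    (∪-lub (image-mono (p⊆p∪q {p = A} B)) (image-mono (q⊆p∪q A B)))
    where
    image-∪-split : ∀ {j} → σ ⟨$⟩ˡ j ∈ A ⊎ σ ⟨$⟩ˡ j ∈ B → j ∈ image σ A ∪ image σ B
    image-∪-split (inj₁ a) = p⊆p∪q (image σ B) (∈-image⁺ {A} a)
    image-∪-split (inj₂ b) = q⊆p∪q (image σ A) (image σ B) (∈-image⁺ {B} b)

  image-∁ : ∀ A → image σ (∁ A) ≡ ∁ (image σ A)
  image-∁ A = ⊆-antisym
    (λ p → x∉p⇒x∈∁p (λ q → x∈∁p⇒x∉p (∈-image⁻ {∁ A} p) (∈-image⁻ {A} q)))
    (λ p → ∈-image⁺ {∁ A} (x∉p⇒x∈∁p (λ q → x∈∁p⇒x∉p p (∈-image⁺ {A} q))))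

  image-⊥ : image σ ⊥ ≡ ⊥
  image-⊥ = ⊆-antisym (λ p → Empty.⊥-elim (∉⊥ (∈-image⁻ p))) ⊥⊆

  image-nonempty : ∀ {A} → Nonempty A → Nonempty (image σ A)
  image-nonempty (x , x∈A) = σ ⟨$⟩ʳ x , ∈-image x∈A

  image-free : ∀ A B → image σ (∁ (A ∪ B)) ≡ ∁ (image σ A ∪ image σ B)
  image-free A B = trans (image-∁ (A ∪ B)) (cong ∁ (image-∪ A B))

  image-legal : ∀ {A B S} → LegalMove A B S → LegalMove (image σ A) (image σ B) (image σ S)
  image-legal {A} {B} (nonempty , S-free) =
    image-nonempty nonempty , ⊆-trans (image-mono S-free) (⊆-reflexive (image-free A B))

image-cancel : ∀ {n} (σ : Permutation′ n) S → image (flip σ) (image σ S) ≡ S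
image-cancel σ S = ⊆-antisym
  (λ p → ∈-image-reflect σ (∈-image⁻ (flip σ) p))
  (λ p → ∈-image⁺ (flip σ) (∈-image σ p))

image-cancel′ : ∀ {n} (σ : Permutation′ n) S → image σ (image (flip σ) S) ≡ S
image-cancel′ σ = image-cancel (flip σ)

pullback-legal : ∀ {n} (σ : Permutation′ n) {A B S} →
                 LegalMove (image σ A) (image σ B) S → LegalMove A B (image (flip σ) S)
pullback-legal σ {A} {B} {S} legal =
  subst₂ (λ A′ B′ → LegalMove A′ B′ (image (flip σ) S))
         (image-cancel σ A) (image-cancel σ B) (image-legal (flip σ) legal)

module _ (G : AvoidanceGame) where

  completes-mono : ∀ {X Y} → X ⊆ Y → CompletesLine G X → CompletesLine G Y
  completes-mono X⊆Y (ℓ , ℓ∈ , ℓ⊆X) = ℓ , ℓ∈ , ⊆-trans ℓ⊆X X⊆Y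

  free-point : ∀ {A B} → IWinsII G A B → Nonempty (∁ (A ∪ B))
  free-point (replyII free _) = free

  replies : ∀ {A B} → IWinsII G A B → ∀ S → LegalMove A B S →
            CompletesLine G (B ∪ S) ⊎ IWinsI G A (B ∪ S)
  replies (replyII _ reply) = reply

  module _ (σ : Permutation′ (size G)) (aut : IsAutomorphism G σ) where

    completes-image : ∀ {X} → CompletesLine G X → CompletesLine G (image σ X)
    completes-image (ℓ , ℓ∈ , ℓ⊆X) = image σ ℓ , proj₁ aut ℓ ℓ∈ , image-mono σ ℓ⊆X

    completes-preimage : ∀ {X} → CompletesLine G (image σ X) → CompletesLine G X
    completes-preimage {X} (ℓ , ℓ∈ , ℓ⊆σX) with proj₂ aut ℓ ℓ∈
    ... | m , m∈ , σm≡ℓ =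
      m , m∈ , image-reflects-⊆ σ (subst (_⊆ image σ X) (sym σm≡ℓ) ℓ⊆σX)

    mutual
      transport-I : ∀ {A B} → IWinsI G A B → IWinsI G (image σ A) (image σ B)
      transport-I {A} {B} (moveI S legal noLine w) =
        moveI (image σ S) (image-legal σ legal)
          (λ line → noLine (completes-preimage
                              (subst (CompletesLine G) (sym (image-∪ σ A S)) line)))
          (subst (λ A′ → IWinsII G A′ (image σ B)) (image-∪ σ A S) (transport-II w))

      transport-II : ∀ {A B} → IWinsII G A B → IWinsII G (image σ A) (image σ B)
      transport-II {A} {B} (replyII free reply) =
        replyII (subst Nonempty (image-free σ A B) (image-nonempty σ free)) reply′
        where
        -- II's answer S in the image game is the image of the answer σ⁻¹[S].
        moved : ∀ S → image σ (B ∪ image (flip σ) S) ≡ image σ B ∪ S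
        moved S = begin
          image σ (B ∪ image (flip σ) S)             ≡⟨ image-∪ σ B _ ⟩
          image σ B ∪ image σ (image (flip σ) S)     ≡⟨ cong (image σ B ∪_) (image-cancel′ σ S) ⟩
          image σ B ∪ S                              ∎
          where open ≡-Reasoning

        reply′ : ∀ S → LegalMove (image σ A) (image σ B) S →
                 CompletesLine G (image σ B ∪ S) ⊎ IWinsI G (image σ A) (image σ B ∪ S)
        reply′ S legal with reply (image (flip σ) S) (pullback-legal σ legal)
        ... | inj₁ line = inj₁ (subst (CompletesLine G) (moved S) (completes-image line))
        ... | inj₂ w    = inj₂ (subst (IWinsI G (image σ A)) (moved S) (transport-I w))

  -- Two games played side by side, (A , B) and (P , Q), where II's points in
  -- the second game are I's points in the first (Q ⊆ A), I's points in the
  -- second game contain II's points in the first (B ⊆ P), and everything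
  -- claimed in the first game is claimed in the second.  II copies I's moves
  -- from one game into the other; if I won both games, the player copying
  -- a move would be the one who completes a line.  Hence I cannot win both.
  mutual
    -- I to move in the first game, II to move in the second; here both
    -- games have the same claimed points.
    mirror-I : ∀ {A B P Q} → IWinsI G A B → IWinsII G P Q →
               Q ⊆ A → B ⊆ P → A ⊆ P ∪ Q → P ⊆ A ∪ B → Empty.⊥
    mirror-I {A} {B} {P} {Q} (moveI S (nonempty , S-free) noLine w₁) (replyII _ reply)
             Q⊆A B⊆P A⊆PQ P⊆AB
      with reply S (nonempty , ⊆-trans S-free (p⊆q⇒∁p⊇∁q PQ⊆AB))
      where
      PQ⊆AB : P ∪ Q ⊆ A ∪ B
      PQ⊆AB = ∪-lub P⊆AB (⊆-trans Q⊆A (p⊆p∪q B))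
    ... | inj₁ line = noLine (completes-mono (∪-mono Q⊆A ⊆-refl) line)
    ... | inj₂ w₂′  = mirror-II w₁ w₂′ (∪-mono Q⊆A ⊆-refl) B⊆P (∪-extend S A⊆PQ)

    -- I's move R in
    -- the second game is answered in the first by T = (P ∪ R) ∖ (A ∪ B),
    -- which brings the claimed points of the two games into agreement.
    mirror-II : ∀ {A B P Q} → IWinsII G A B → IWinsI G P Q →
                Q ⊆ A → B ⊆ P → A ⊆ P ∪ Q → Empty.⊥
    mirror-II {A} {B} {P} {Q} (replyII _ reply) (moveI R ((r , r∈R) , R-free) noLine w₂)
              Q⊆A B⊆P A⊆PQ
      with reply ((P ∪ R) ∩ ∁ (A ∪ B)) ((r , r∈T) , p∩q⊆q (P ∪ R) (∁ (A ∪ B)))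
      where
      r∈T : r ∈ (P ∪ R) ∩ ∁ (A ∪ B)
      r∈T = x∈p∩q⁺ (q⊆p∪q P R r∈R ,
        x∉p⇒x∈∁p (λ r∈AB → x∈∁p⇒x∉p (R-free r∈R) (∪-lub A⊆PQ (⊆-trans B⊆P (p⊆p∪q Q)) r∈AB)))
    ... | inj₁ line = noLine (completes-mono (∪-lub (⊆-trans B⊆P (p⊆p∪q R)) (p∩q⊆p _ _)) line)
    ... | inj₂ w₁′ =
      mirror-I w₁′ w₂ Q⊆A (∪-lub (⊆-trans B⊆P (p⊆p∪q R)) (p∩q⊆p _ _))
        (⊆-trans A⊆PQ (∪-mono (p⊆p∪q R) ⊆-refl)) PR⊆ABT
      where
      PR⊆ABT : P ∪ R ⊆ A ∪ (B ∪ ((P ∪ R) ∩ ∁ (A ∪ B)))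
      PR⊆ABT = ⊆-trans (⊆-∪-diff (P ∪ R) (A ∪ B)) (⊆-reflexive (∪-assoc A B _))

  -- In the position (σ[A] , ∅), which I also
  -- wins, II answers A ∖ σ[A] and mirrors the original game.
  no-steal : ∀ {A x} σ → IsAutomorphism G σ → IWinsII G A ⊥ → ¬ CompletesLine G A →
             x ∈ A → x ∉ image σ A → Empty.⊥
  no-steal {A} {x} σ aut w noLine x∈A x∉σA
    with replies (subst (IWinsII G (image σ A)) (image-⊥ σ) (transport-II σ aut w))
                 (A ∩ ∁ (image σ A))
                 ((x , x∈p∩q⁺ (x∈A , x∉p⇒x∈∁p x∉σA)) ,
                  ⊆-trans (p∩q⊆q A _) (p⊆q⇒∁p⊇∁q (∪-lub ⊆-refl ⊥⊆)))
  ... | inj₁ line = noLine (completes-mono (∪-lub ⊥⊆ (p∩q⊆p A _)) line)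
  ... | inj₂ w′ =
    mirror-II w w′ (∪-lub ⊥⊆ (p∩q⊆p A _)) ⊥⊆
      (⊆-trans (⊆-∪-diff A (image σ A)) (∪-mono ⊆-refl (q⊆p∪q ⊥ _)))

-- I's opening S leaves a free point y; an automorphism σ with σ y = x ∈ S
-- moves x off σ[S] (σ⁻¹ x = y is unclaimed), so stealing applies.
theorem4 : (G : AvoidanceGame) → Transitive G → ¬ PlayerIWin G
theorem4 G transitive (moveI S ((x , x∈S) , _) noLine w)
  with free-point G w
... | y , y-free with transitive y x
... | σ , aut , σy≡x = no-steal G σ aut w noLine (q⊆p∪q ⊥ S x∈S) x∉σA
  where
  x∉σA : x ∉ image σ (⊥ ∪ S)
  x∉σA x∈σA = x∈∁p⇒x∉p y-free
    (p⊆p∪q ⊥ (∈-image-reflect σ (subst (_∈ image σ (⊥ ∪ S)) (sym σy≡x) x∈σA)))
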